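{- Let $(p\colon\mathbb{E}\to\mathbb{B},O,\Omega)$ and $(q\colon\mathbb{F}\to\mathbb{C},O',\Pi)$ be $\mathbf{CLat}_\sqcap$-fibrations with truth values indexed by the same discrete category $A$, let $F\colon\mathbb{B}\to\mathbb{C}$ and $\tau\colon F\circ O\Rightarrow O'$. For any lifting $\dot F\colon\mathbb{E}\to\mathbb{F}$ of $F$ along $p,q$ (i.e. $q\circ\dot F=F\circ p$), we have $\dot F(P)\sqsubseteq F^{\Omega,\Pi}_{\tau}(P)$ for all $P\in\mathbb{E}$ if and only if for every $a\in A$, $\tau_a$ underlies an $\mathbb{F}$-morphism $\dot F(\Omega(a))\to\Pi(a)$, i.e. $\dot F(\Omega(a))\sqsubseteq\tau_a^*\Pi(a)$ (equivalently, $\tau$ lifts to a natural transformation $\dot F\circ\Omega\Rightarrow\Pi$).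
   Context: A $\mathbf{CLat}_\sqcap$-fibration is a posetal fibration whose fibers are complete lattices (order $\sqsubseteq$, meet $\bigwedge$) with meet-preserving reindexing $f^*$; a $\mathbf{CLat}_\sqcap$-fibration with truth values is $(p,O\colon A\to\mathbb{B},\Omega\colon A\to\mathbb{E})$ with $A$ discrete and $O=p\circ\Omega$. The generalized codensity lifting is $F^{\Omega,\Pi}_{\tau}(P)=\bigwedge_{a\in A,\,k\in\mathbb{E}(P,\Omega(a))}(\tau_a\circ F(pk))^*(\Pi(a))$. -}

module Defs where

open import Level using (Level; suc; _⊔_)
open import Data.Product using (Σ; _,_)
open import Relation.Binary.PropositionalEquality using (_≡_)
open import Relation.Binary.Bundles using (Poset)

record Category (ℓ : Level) : Set (suc ℓ) where
  infixr 9 _∘_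
  field
    Obj  : Set ℓ
    Hom  : Obj → Obj → Set ℓ
    id   : {X : Obj} → Hom X X
    _∘_  : {X Y Z : Obj} → Hom Y Z → Hom X Y → Hom X Z
    identityˡ : {X Y : Obj} (f : Hom X Y) → id ∘ f ≡ f
    identityʳ : {X Y : Obj} (f : Hom X Y) → f ∘ id ≡ f
    assoc : {W X Y Z : Obj} (h : Hom Y Z) (g : Hom X Y) (f : Hom W X) →
            (h ∘ g) ∘ f ≡ h ∘ (g ∘ f)

record Functor {ℓ : Level} (B C : Category ℓ) : Set ℓ where
  private
    module B = Category B
    module C = Category C
  field
    F₀ : B.Obj → C.Obj
    F₁ : {X Y : B.Obj} → B.Hom X Y → C.Hom (F₀ X) (F₀ Y)
    F-id : {X : B.Obj} → F₁ (B.id {X}) ≡ C.id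
    F-∘  : {X Y Z : B.Obj} (g : B.Hom Y Z) (f : B.Hom X Y) →
           F₁ (g B.∘ f) ≡ F₁ g C.∘ F₁ f

record CompleteLattice (ℓ : Level) : Set (suc ℓ) where
  field
    poset : Poset ℓ ℓ ℓ
  open Poset poset public
  field
    ⋀ : {I : Set ℓ} → (I → Carrier) → Carrier
    ⋀-lower : {I : Set ℓ} (g : I → Carrier) (i : I) → ⋀ g ≤ g i
    ⋀-greatest : {I : Set ℓ} (g : I → Carrier) (x : Carrier) →
                 ((i : I) → x ≤ g i) → x ≤ ⋀ g

-- A CLat_⊓-fibration over B, in its (split, since posetal) indexed presentation:
-- each fibre E_X is a complete lattice, reindexing f* is monotone, preserves
-- all meets, and is functorial.  The total category 𝔼 has objects (X , P) with
-- P ∈ E_X, and a (necessarily unique) morphism (X , P) → (Y , Q) over f : X → Y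
-- iff P ⊑ f* Q;  p : 𝔼 → B is the first projection.
record CLatFibration {ℓ : Level} (B : Category ℓ) : Set (suc ℓ) where
  open Category B
  field
    Fib : Obj → CompleteLattice ℓ
  Pred : Obj → Set ℓ
  Pred X = CompleteLattice.Carrier (Fib X)
  _⊑_ : {X : Obj} → Pred X → Pred X → Set ℓ
  _⊑_ {X} P Q = CompleteLattice._≤_ (Fib X) P Q
  _≈_ : {X : Obj} → Pred X → Pred X → Set ℓ
  _≈_ {X} P Q = CompleteLattice._≈_ (Fib X) P Q
  field
    _* : {X Y : Obj} → Hom X Y → Pred Y → Pred X
    *-mono : {X Y : Obj} (f : Hom X Y) {P Q : Pred Y} →
             P ⊑ Q → (f *) P ⊑ (f *) Q
    *-⋀ : {X Y : Obj} (f : Hom X Y) {I : Set ℓ} (g : I → Pred Y) →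
          (f *) (CompleteLattice.⋀ (Fib Y) g) ≈ CompleteLattice.⋀ (Fib X) (λ i → (f *) (g i))
    *-id : {X : Obj} (P : Pred X) → (id *) P ≈ P
    *-∘ : {X Y Z : Obj} (g : Hom Y Z) (f : Hom X Y) (P : Pred Z) →
          ((g ∘ f) *) P ≈ (f *) ((g *) P)
  EHom : {X Y : Obj} → Pred X → Pred Y → Set ℓ
  EHom {X} {Y} P Q = Σ (Hom X Y) (λ f → P ⊑ (f *) Q)

-- Truth values indexed by a discrete category A (a set):
-- Ω : A → 𝔼,  O = p ∘ Ω : A → B.
record TruthValues {ℓ : Level} {B : Category ℓ} (p : CLatFibration B) (A : Set ℓ) : Set ℓ where
  field
    O : A → Category.Obj B
    Ω : (a : A) → CLatFibration.Pred p (O a)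

-- Since both
-- fibrations are posetal, a functor over F is exactly an object map sending
-- P ∈ E_X to Ḟ P ∈ F_{F X} such that every 𝔼-morphism over f is sent to an
-- 𝔽-morphism over F f.
record Lifting {ℓ : Level} {B C : Category ℓ} (p : CLatFibration B) (q : CLatFibration C)
               (F : Functor B C) : Set ℓ where
  open Functor F
  private
    module B = Category B
    module p = CLatFibration p
    module q = CLatFibration q
  field
    Ḟ₀ : {X : B.Obj} → p.Pred X → q.Pred (F₀ X)
    Ḟ₁ : {X Y : B.Obj} {P : p.Pred X} {Q : p.Pred Y} (f : B.Hom X Y) →
         P p.⊑ (f p.*) Q → Ḟ₀ P q.⊑ ((F₁ f) q.*) (Ḟ₀ Q)

-- The generalized codensity lifting
-- F^{Ω,Π}_τ(P) = ⋀_{a ∈ A, k ∈ 𝔼(P, Ω a)} (τ_a ∘ F(p k))* (Π a).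
-- τ : F ∘ O ⇒ O′ is a family τ_a : F (O a) → O′ a (naturality is vacuous as A is discrete).
codensity : {ℓ : Level} {B C : Category ℓ} (p : CLatFibration B) (q : CLatFibration C)
            {A : Set ℓ} (Ωs : TruthValues p A) (Πs : TruthValues q A)
            (F : Functor B C)
            (τ : (a : A) → Category.Hom C (Functor.F₀ F (TruthValues.O Ωs a)) (TruthValues.O Πs a))
            {X : Category.Obj B} → CLatFibration.Pred p X → CLatFibration.Pred q (Functor.F₀ F X)
codensity {B = B} {C} p q {A} Ωs Πs F τ {X} P =
  CompleteLattice.⋀ (CLatFibration.Fib q (Functor.F₀ F X))
    {I = Σ A (λ a → CLatFibration.EHom p P (TruthValues.Ω Ωs a))}
    (λ { (a , (f , _)) → CLatFibration._* q (Category._∘_ C (τ a) (Functor.F₁ F f)) (TruthValues.Ω Πs a) })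

-- Instantiating P = Ω(a) with the identity morphism
-- shows that Ḟ ⊑ F^{Ω,Π}_τ forces Ḟ(Ω a) ⊑ τ_a* Π(a).  Conversely, a lifting
-- sends f : P → Ω(a) to Ḟ P ⊑ (F f)* Ḟ(Ω a), and monotonicity and functoriality
-- of reindexing turn Ḟ(Ω a) ⊑ τ_a* Π(a) into Ḟ P ⊑ (τ_a ∘ F f)* Π(a) for every
-- such f, hence Ḟ P lies below their meet.
module Submission where

open import Defs
open import Level using (Level)
open import Data.Product using (_×_; _,_)
open import Relation.Binary.PropositionalEquality using (_≡_; subst; trans; cong)
import Relation.Binary.Reasoning.PartialOrder as PosetReasoning

module Reindexing {ℓ : Level} {B : Category ℓ} (p : CLatFibration B) where
  open Category B
  open CLatFibration p

  module Fibre (X : Obj) = CompleteLattice (Fib X)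

  ⊑-trans : {X : Obj} {P Q R : Pred X} → P ⊑ Q → Q ⊑ R → P ⊑ R
  ⊑-trans {X} = Fibre.trans X

  ⊑-id* : {X : Obj} (P : Pred X) → P ⊑ (id *) P
  ⊑-id* {X} P = Fibre.reflexive X (Fibre.Eq.sym X (*-id P))

  *∘*-⊑-∘* : {X Y Z : Obj} (g : Hom Y Z) (f : Hom X Y) (P : Pred Z) →
             (f *) ((g *) P) ⊑ ((g ∘ f) *) P
  *∘*-⊑-∘* {X} g f P = Fibre.reflexive X (Fibre.Eq.sym X (*-∘ g f P))

  idEHom : {X : Obj} (P : Pred X) → EHom P P
  idEHom P = id , ⊑-id* P

module Codensity {ℓ : Level} {B C : Category ℓ} (p : CLatFibration B) (q : CLatFibration C)
                 {A : Set ℓ} (Ωs : TruthValues p A) (Πs : TruthValues q A) (F : Functor B C)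
                 (τ : (a : A) → Category.Hom C (Functor.F₀ F (TruthValues.O Ωs a)) (TruthValues.O Πs a))
                 where
  private
    module B = Category B
    module C = Category C
    module p = CLatFibration p
    module F = Functor F
    open TruthValues Ωs using (Ω)
    open TruthValues Πs using () renaming (Ω to Π)
  open CLatFibration q
  open Reindexing q

  codensity-⊑ : {X : B.Obj} (P : p.Pred X) (a : A) ((f , _) : p.EHom P (Ω a)) →
                codensity p q Ωs Πs F τ P ⊑ ((τ a C.∘ F.F₁ f) *) (Π a)
  codensity-⊑ {X} P a k = Fibre.⋀-lower (F.F₀ X) _ (a , k)

  ⊑-codensity : {X : B.Obj} (P : p.Pred X) (R : Pred (F.F₀ X)) →
                ((a : A) ((f , _) : p.EHom P (Ω a)) → R ⊑ ((τ a C.∘ F.F₁ f) *) (Π a)) →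
                R ⊑ codensity p q Ωs Πs F τ P
  ⊑-codensity {X} P R below = Fibre.⋀-greatest (F.F₀ X) _ R (λ (a , k) → below a k)

  τ∘F-id : (a : A) → τ a C.∘ F.F₁ B.id ≡ τ a
  τ∘F-id a = trans (cong (τ a C.∘_) F.F-id) (C.identityʳ (τ a))

  codensity-Ω-⊑ : (a : A) → codensity p q Ωs Πs F τ (Ω a) ⊑ (τ a *) (Π a)
  codensity-Ω-⊑ a =
    subst (λ g → codensity p q Ωs Πs F τ (Ω a) ⊑ (g *) (Π a)) (τ∘F-id a)
          (codensity-⊑ (Ω a) a (Reindexing.idEHom p (Ω a)))

  module _ (Ḟ : Lifting p q F) where
    open Lifting Ḟ

    Ḟ-⊑-reindexed-τ : (∀ a → Ḟ₀ (Ω a) ⊑ (τ a *) (Π a)) →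
                      {X : B.Obj} (P : p.Pred X) (a : A) ((f , _) : p.EHom P (Ω a)) →
                      Ḟ₀ P ⊑ ((τ a C.∘ F.F₁ f) *) (Π a)
    Ḟ-⊑-reindexed-τ τ-lifts {X} P a (f , P⊑f*Ωa) = begin
      Ḟ₀ P                            ≤⟨ Ḟ₁ f P⊑f*Ωa ⟩
      (F.F₁ f *) (Ḟ₀ (Ω a))           ≤⟨ *-mono (F.F₁ f) (τ-lifts a) ⟩
      (F.F₁ f *) ((τ a *) (Π a))      ≤⟨ *∘*-⊑-∘* (τ a) (F.F₁ f) (Π a) ⟩
      ((τ a C.∘ F.F₁ f) *) (Π a)      ∎
      where open PosetReasoning (Fibre.poset (F.F₀ X))

theorem3 : {ℓ : Level} {B C : Category ℓ} (p : CLatFibration B) (q : CLatFibration C)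
    {A : Set ℓ} (Ωs : TruthValues p A) (Πs : TruthValues q A) (F : Functor B C)
    (τ : (a : A) → Category.Hom C (Functor.F₀ F (TruthValues.O Ωs a)) (TruthValues.O Πs a))
    (Ḟ : Lifting p q F) →
    (((X : Category.Obj B) (P : CLatFibration.Pred p X) →
        CLatFibration._⊑_ q (Lifting.Ḟ₀ Ḟ P) (codensity p q Ωs Πs F τ P))
      → ((a : A) →
        CLatFibration._⊑_ q (Lifting.Ḟ₀ Ḟ (TruthValues.Ω Ωs a))
          (CLatFibration._* q (τ a) (TruthValues.Ω Πs a))))
    × (((a : A) →
        CLatFibration._⊑_ q (Lifting.Ḟ₀ Ḟ (TruthValues.Ω Ωs a))
          (CLatFibration._* q (τ a) (TruthValues.Ω Πs a)))
      → ((X : Category.Obj B) (P : CLatFibration.Pred p X) →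
        CLatFibration._⊑_ q (Lifting.Ḟ₀ Ḟ P) (codensity p q Ωs Πs F τ P)))
theorem3 p q Ωs Πs F τ Ḟ =
    (λ Ḟ⊑codensity a →
       ⊑-trans (Ḟ⊑codensity _ (Ω a)) (codensity-Ω-⊑ a))
  , (λ τ-lifts X P →
       ⊑-codensity P (Lifting.Ḟ₀ Ḟ P) (Ḟ-⊑-reindexed-τ Ḟ τ-lifts P))
  where
  open Codensity p q Ωs Πs F τ
  open Reindexing q using (⊑-trans)
  open TruthValues Ωs using (Ω)
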